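{- For all $m\ge1$ and $n\ge1$, $\displaystyle R_{n+m}=R_nR_m+\sum_{i=1}^{n}\sum_{j=1}^{m}R_{n-i}R_{m-j}\widetilde R_{i+j}$.
   Context: Let $q\ge 4$ be an integer and consider the regular square mosaic $\{4,q\}$ (Schläfli symbol), i.e. the tiling of the Euclidean plane ($q=4$) or of the hyperbolic plane ($q\ge5$) by congruent regular squares with $q$ squares around each vertex. For $n\ge1$ the $(2\times n)$-board is defined as follows. Choose a square $S_1$ of the mosaic with vertices $A_0,A_1,B_1,B_0$ in cyclic order. Inductively, for $i\ge1$ let $S_{i+1}$ be the other square of the mosaic containing the edge $A_iB_i$, with vertices $A_i,A_{i+1},B_{i+1},B_i$ in cyclic order. The first level of the board consists of $S_1,\dots,S_n$; the second level consists of all squares of the mosaic having at least one vertex in $\{A_1,\dots,A_n\}$ and no vertex in $\{B_1,\dots,B_n,A_{n+1}\}$ (here $A_{n+1}$ is the vertex of $S_{n+1}$). The board is the union of both levels. For $1\le j\le n$ the $j$-th column consists of $S_j$ together with the second-level squares that contain $A_j$ but not $A_{j+1}$. A domino is a pair of squares of the board sharing an edge. Given positive integers $a,b$, a colored tiling is a partition of the squares of the board into single squares and dominoes, each single square receiving one of $a$ colors and each domino one of $b$ colors. A tiling is breakable in position $i$ ($1\le i\le n-1$) if no domino contains a square of the first $i$ columns and a square of the remaining columns; it is unbreakable if it is breakable in no position. $R_n$ is the number of colored tilings of the $(2\times n)$-board ($R_0=1$) and $\widetilde R_n$ the number of unbreakable colored tilings of it. -}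

module Defs where

open import Data.Nat using (ℕ; zero; suc; _+_; _*_; _∸_; _^_; _≡ᵇ_; _<ᵇ_)
open import Data.Bool using (Bool; true; false; _∧_; _∨_; not; if_then_else_)
open import Data.Product using (_×_; _,_)
open import Data.List using (List; []; _∷_; _++_; map; concatMap; upTo; length)
open import Data.Nat.ListAction using (sum)

-- A square is (j , k) with j < n the (0-based) column index and
-- k < q ∸ 2 its position inside the column:
--   k = 0            : the first-level square S_{j+1}
--   k = 1            : the second-level square E_{j+1} sharing the edge A_j A_{j+1} with S_{j+1}
--   k = 2 .. q ∸ 3   : the q-4 second-level squares M_{j+1,1..q-4} around A_{j+1}
--                      (between E_{j+1} and E_{j+2} in the cyclic order around A_{j+1}).
Square : Set
Square = ℕ × ℕ

-- A potential domino = pair of squares of the board sharing an edge.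
Edge : Set
Edge = Square × Square

-- Edges (adjacent pairs) inside column j, for the mosaic {4,q}:
--   S - E, and the chain E - M_1 - ... - M_{q-4}.
columnEdges : ℕ → ℕ → List Edge
columnEdges q j = ((j , 0) , (j , 1)) ∷ map (λ k → ((j , suc k) , (j , suc (suc k)))) (upTo (q ∸ 4))

-- Edges between column j and column j+1:  S_{j+1} - S_{j+2}, and
-- the last second-level square of column j (around A_{j+1}) - E_{j+2}.
crossEdges : ℕ → ℕ → List Edge
crossEdges q j = ((j , 0) , (suc j , 0)) ∷ ((j , q ∸ 3) , (suc j , 1)) ∷ []

boardEdges : ℕ → ℕ → List Edge
boardEdges q n = concatMap (λ j → columnEdges q j ++ (if suc j <ᵇ n then crossEdges q j else [])) (upTo n)

boardSize : ℕ → ℕ → ℕ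
boardSize q n = n * (q ∸ 2)

subsets : {A : Set} → List A → List (List A)
subsets [] = [] ∷ []
subsets (x ∷ xs) = subsets xs ++ map (x ∷_) (subsets xs)

filterᵇ : {A : Set} → (A → Bool) → List A → List A
filterᵇ p [] = []
filterᵇ p (x ∷ xs) = if p x then x ∷ filterᵇ p xs else filterᵇ p xs

allᵇ : {A : Set} → (A → Bool) → List A → Bool
allᵇ p [] = true
allᵇ p (x ∷ xs) = p x ∧ allᵇ p xs

anyᵇ : {A : Set} → (A → Bool) → List A → Bool
anyᵇ p [] = false
anyᵇ p (x ∷ xs) = p x ∨ anyᵇ p xs

sqEq : Square → Square → Bool
sqEq (j , k) (j' , k') = (j ≡ᵇ j') ∧ (k ≡ᵇ k')

disjoint : Edge → Edge → Bool
disjoint (x , y) (u , v) = not (sqEq x u ∨ sqEq x v ∨ sqEq y u ∨ sqEq y v)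

isMatching : List Edge → Bool
isMatching [] = true
isMatching (e ∷ es) = allᵇ (disjoint e) es ∧ isMatching es

-- Tilings of the board by squares and dominoes = sets of pairwise disjoint
-- dominoes (the uncovered squares are the single squares).
tilings : ℕ → ℕ → List (List Edge)
tilings q n = filterᵇ isMatching (subsets (boardEdges q n))

-- number of colorings of a tiling: a colors per single square, b per domino
colorings : ℕ → ℕ → ℕ → ℕ → List Edge → ℕ
colorings q a b n M = a ^ (boardSize q n ∸ 2 * length M) * b ^ length M

R : ℕ → ℕ → ℕ → ℕ → ℕ
R q a b n = sum (map (colorings q a b n) (tilings q n))

crosses : ℕ → Edge → Bool
crosses i ((j , _) , (j' , _)) = ((j <ᵇ i) ∧ not (j' <ᵇ i)) ∨ ((j' <ᵇ i) ∧ not (j <ᵇ i))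

breakable : ℕ → List Edge → Bool
breakable i M = not (anyᵇ (crosses i) M)

unbreakable : ℕ → List Edge → Bool
unbreakable n M = allᵇ (λ i → not (breakable (suc i) M)) (upTo (n ∸ 1))

Rt : ℕ → ℕ → ℕ → ℕ → ℕ
Rt q a b n = sum (map (colorings q a b n) (filterᵇ (unbreakable n) (tilings q n)))

Σ1 : ℕ → (ℕ → ℕ) → ℕ
Σ1 zero f = 0
Σ1 (suc n) f = Σ1 n f + f (suc n)

-- Cutting a tiling of the (2×N)-board after its last break gives the renewal equation
-- R_N = Σ_{k=1}^{N} R_{N-k} R̃_k (N ≥ 1), and this equation alone implies the identity: sorting the
-- tilings of n + m columns by whether the cut after column n falls inside an unbreakable block,
-- say the block of columns n-i+1 … n+j, gives R_n R_m plus the double sum.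
--
-- The renewal equation comes from a transfer matrix. Scan the board column by column; the state
-- at a cut is the set of dominoes crossing it (the first-level one, the second-level one, both or
-- none). As the mosaic is homogeneous, the weight of a column depends only on its incoming and
-- outgoing states, and unbreakable tilings are the state sequences with no empty inner cut.
-- The colouring weight a^(single squares) b^(dominoes) factors over the columns because the
-- squares covered inside a column are pairwise distinct, a pigeonhole count that keeps the
-- truncated subtractions in the exponents exact.

module Submission where

open import Defs
open import Data.Bool using (Bool; true; false; _∧_; _∨_; not; if_then_else_)
open import Data.Bool.Properties
  using (∧-commutativeMonoid; ∧-assoc; ∧-comm; ∧-identityʳ; ∨-identityʳ; ∨-zeroʳ; ∨-distribˡ-∧;
         not-involutive)
open import Data.Nat using (ℕ; zero; suc; _+_; _*_; _∸_; _^_; _≤_; _<_; z≤n; s≤s; _≡ᵇ_; _<ᵇ_)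
open import Data.Nat.Properties
open import Data.Nat.Induction using (<-rec)
open import Data.Nat.ListAction using (sum)
open import Data.Nat.ListAction.Properties using (sum-++)
open import Data.Nat.Tactic.RingSolver using (solve-∀)
open import Data.Product using (_×_; _,_; proj₁; proj₂)
open import Data.Sum using (inj₁; inj₂)
open import Data.List using (List; []; _∷_; _++_; map; length; upTo; concatMap; cartesianProduct)
open import Data.List.Properties
  using (map-++; map-∘; ++-assoc; ++-identityʳ; length-++; length-map; concatMap-++; upTo-∷ʳ; length-upTo)
open import Data.List.Relation.Unary.All using (All; []; _∷_)
import Data.List.Relation.Unary.All as All
import Data.List.Relation.Unary.All.Properties as All
open import Data.List.Relation.Unary.Any using (here; there)
open import Data.List.Relation.Unary.AllPairs using ([]; _∷_)
open import Data.List.Relation.Unary.Unique.Propositional using (Unique)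
import Data.List.Relation.Unary.Unique.Propositional.Properties as Unique
open import Data.List.Relation.Binary.Disjoint.Propositional using (Disjoint)
open import Data.List.Relation.Binary.Subset.Propositional using (_⊆_)
open import Data.List.Membership.Propositional using (_∈_)
open import Data.List.Membership.Propositional.Properties
  using (∈-∃++; ∈-++⁻; ∈-++⁺ˡ; ∈-++⁺ʳ; ∈-upTo⁺; ∈-upTo⁻; ∈-cartesianProduct⁺)
open import Function using (_∘_; id)
open import Relation.Nullary using (contradiction)
open import Relation.Binary.PropositionalEquality
open import Algebra.Bundles using (CommutativeMonoid)
open import Algebra.Properties.CommutativeSemigroup +-commutativeSemigroup
  using () renaming (interchange to +-interchange)
open import Algebra.Properties.CommutativeSemigroup *-commutativeSemigroup
  using () renaming (xy∙z≈xz∙y to *-right-comm)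
open import Algebra.Properties.CommutativeSemigroup (CommutativeMonoid.commutativeSemigroup ∧-commutativeMonoid)
  using () renaming (interchange to ∧-interchange; x∙yz≈y∙xz to ∧-left-comm)

⟦_⟧ : Bool → ℕ
⟦ true ⟧ = 1
⟦ false ⟧ = 0

⟦∧⟧ : ∀ x y → ⟦ x ∧ y ⟧ ≡ ⟦ x ⟧ * ⟦ y ⟧
⟦∧⟧ true y = sym (+-identityʳ ⟦ y ⟧)
⟦∧⟧ false y = refl

⟦⟧-guard : ∀ c {x y} → (c ≡ true → x ≡ y) → ⟦ c ⟧ * x ≡ ⟦ c ⟧ * y
⟦⟧-guard true eq = cong (1 *_) (eq refl)
⟦⟧-guard false eq = refl

sum-map-filterᵇ : {A : Set} (P : A → Bool) (f : A → ℕ) (xs : List A) →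
  sum (map f (filterᵇ P xs)) ≡ sum (map (λ x → ⟦ P x ⟧ * f x) xs)
sum-map-filterᵇ P f [] = refl
sum-map-filterᵇ P f (x ∷ xs) with P x
... | true = cong₂ _+_ (sym (+-identityʳ (f x))) (sum-map-filterᵇ P f xs)
... | false = sum-map-filterᵇ P f xs

Σ⊆ : {A : Set} → List A → (List A → ℕ) → ℕ
Σ⊆ [] F = F []
Σ⊆ (x ∷ xs) F = Σ⊆ xs F + Σ⊆ xs (F ∘ (x ∷_))

module _ {A : Set} where

  sum-map-subsets : (xs : List A) (F : List A → ℕ) → sum (map F (subsets xs)) ≡ Σ⊆ xs F
  sum-map-subsets [] F = +-identityʳ (F [])
  sum-map-subsets (x ∷ xs) F = begin
    sum (map F (subsets xs ++ map (x ∷_) (subsets xs)))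
      ≡⟨ cong sum (map-++ F (subsets xs) _) ⟩
    sum (map F (subsets xs) ++ map F (map (x ∷_) (subsets xs)))
      ≡⟨ sum-++ (map F (subsets xs)) _ ⟩
    sum (map F (subsets xs)) + sum (map F (map (x ∷_) (subsets xs)))
      ≡⟨ cong (λ l → sum (map F (subsets xs)) + sum l) (map-∘ (subsets xs)) ⟨
    sum (map F (subsets xs)) + sum (map (F ∘ (x ∷_)) (subsets xs))
      ≡⟨ cong₂ _+_ (sum-map-subsets xs F) (sum-map-subsets xs (F ∘ (x ∷_))) ⟩
    Σ⊆ (x ∷ xs) F ∎
    where open ≡-Reasoning

  Σ⊆-++ : (xs ys : List A) (F : List A → ℕ) →
    Σ⊆ (xs ++ ys) F ≡ Σ⊆ xs (λ S → Σ⊆ ys (λ T → F (S ++ T)))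
  Σ⊆-++ [] ys F = refl
  Σ⊆-++ (x ∷ xs) ys F = cong₂ _+_ (Σ⊆-++ xs ys F) (Σ⊆-++ xs ys (F ∘ (x ∷_)))

  Σ⊆-cong : (xs : List A) {F G : List A → ℕ} → (∀ S → F S ≡ G S) → Σ⊆ xs F ≡ Σ⊆ xs G
  Σ⊆-cong [] eq = eq []
  Σ⊆-cong (x ∷ xs) eq = cong₂ _+_ (Σ⊆-cong xs eq) (Σ⊆-cong xs (eq ∘ (x ∷_)))

  Σ⊆-congᴬ : {P : A → Set} (xs : List A) {F G : List A → ℕ} → All P xs →
    (∀ S → All P S → F S ≡ G S) → Σ⊆ xs F ≡ Σ⊆ xs G
  Σ⊆-congᴬ [] _ eq = eq [] []
  Σ⊆-congᴬ (x ∷ xs) (px ∷ pxs) eq =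
    cong₂ _+_ (Σ⊆-congᴬ xs pxs eq) (Σ⊆-congᴬ xs pxs (λ S pS → eq (x ∷ S) (px ∷ pS)))

  Σ⊆-+ : (xs : List A) (F G : List A → ℕ) → Σ⊆ xs (λ S → F S + G S) ≡ Σ⊆ xs F + Σ⊆ xs G
  Σ⊆-+ [] F G = refl
  Σ⊆-+ (x ∷ xs) F G = begin
    Σ⊆ xs (λ S → F S + G S) + Σ⊆ xs (λ S → F (x ∷ S) + G (x ∷ S))
      ≡⟨ cong₂ _+_ (Σ⊆-+ xs F G) (Σ⊆-+ xs _ _) ⟩
    (Σ⊆ xs F + Σ⊆ xs G) + (Σ⊆ xs (F ∘ (x ∷_)) + Σ⊆ xs (G ∘ (x ∷_)))
      ≡⟨ +-interchange (Σ⊆ xs F) (Σ⊆ xs G) _ _ ⟩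
    Σ⊆ (x ∷ xs) F + Σ⊆ (x ∷ xs) G ∎
    where open ≡-Reasoning

  Σ⊆-*ˡ : (xs : List A) (c : ℕ) (F : List A → ℕ) → Σ⊆ xs (λ S → c * F S) ≡ c * Σ⊆ xs F
  Σ⊆-*ˡ [] c F = refl
  Σ⊆-*ˡ (x ∷ xs) c F =
    trans (cong₂ _+_ (Σ⊆-*ˡ xs c F) (Σ⊆-*ˡ xs c _)) (sym (*-distribˡ-+ c _ _))

  Σ⊆-map : {B : Set} (f : A → B) (xs : List A) (F : List B → ℕ) → Σ⊆ (map f xs) F ≡ Σ⊆ xs (F ∘ map f)
  Σ⊆-map f [] F = refl
  Σ⊆-map f (x ∷ xs) F = cong₂ _+_ (Σ⊆-map f xs F) (Σ⊆-map f xs _)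

  Σ⊆-*ʳ : (xs : List A) (c : ℕ) (F : List A → ℕ) → Σ⊆ xs (λ S → F S * c) ≡ Σ⊆ xs F * c
  Σ⊆-*ʳ xs c F = trans (Σ⊆-cong xs (λ S → *-comm (F S) c)) (trans (Σ⊆-*ˡ xs c F) (*-comm c _))

Σ1-cong : ∀ n {f g : ℕ → ℕ} → (∀ i → 1 ≤ i → i ≤ n → f i ≡ g i) → Σ1 n f ≡ Σ1 n g
Σ1-cong zero eq = refl
Σ1-cong (suc n) eq =
  cong₂ _+_ (Σ1-cong n (λ i 1≤i i≤n → eq i 1≤i (m≤n⇒m≤1+n i≤n))) (eq (suc n) (s≤s z≤n) ≤-refl)

Σ1-+ : ∀ n (f g : ℕ → ℕ) → Σ1 n (λ i → f i + g i) ≡ Σ1 n f + Σ1 n g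
Σ1-+ zero f g = refl
Σ1-+ (suc n) f g =
  trans (cong (_+ (f (suc n) + g (suc n))) (Σ1-+ n f g)) (+-interchange (Σ1 n f) (Σ1 n g) _ _)

Σ1-*ˡ : ∀ n c (f : ℕ → ℕ) → Σ1 n (λ i → c * f i) ≡ c * Σ1 n f
Σ1-*ˡ zero c f = sym (*-zeroʳ c)
Σ1-*ˡ (suc n) c f = trans (cong (_+ c * f (suc n)) (Σ1-*ˡ n c f)) (sym (*-distribˡ-+ c _ _))

Σ1-*ʳ : ∀ n c (f : ℕ → ℕ) → Σ1 n (λ i → f i * c) ≡ Σ1 n f * c
Σ1-*ʳ n c f = trans (Σ1-cong n (λ i _ _ → *-comm (f i) c)) (trans (Σ1-*ˡ n c f) (*-comm c _))

Σ1-suc : ∀ n (f : ℕ → ℕ) → Σ1 (suc n) f ≡ f 1 + Σ1 n (f ∘ suc)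
Σ1-suc zero f = sym (+-identityʳ (f 1))
Σ1-suc (suc n) f = trans (cong (_+ f (2 + n)) (Σ1-suc n f)) (+-assoc (f 1) _ _)

Σ1-+-range : ∀ n m (f : ℕ → ℕ) → Σ1 (n + m) f ≡ Σ1 n f + Σ1 m (λ j → f (n + j))
Σ1-+-range n zero f = trans (cong (λ k → Σ1 k f) (+-identityʳ n)) (sym (+-identityʳ _))
Σ1-+-range n (suc m) f rewrite +-suc n m =
  trans (cong (_+ f (suc (n + m))) (Σ1-+-range n m f)) (+-assoc (Σ1 n f) _ _)

Σ1-reverse : ∀ n (f : ℕ → ℕ) → Σ1 n f ≡ Σ1 n (λ i → f (suc n ∸ i))
Σ1-reverse zero f = refl
Σ1-reverse (suc n) f = begin
  Σ1 n f + f (suc n)                       ≡⟨ cong (_+ f (suc n)) (Σ1-reverse n f) ⟩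
  Σ1 n (λ i → f (suc n ∸ i)) + f (suc n)   ≡⟨ +-comm _ (f (suc n)) ⟩
  f (suc n) + Σ1 n (λ i → f (suc n ∸ i))   ≡⟨ Σ1-suc n (λ i → f (2 + n ∸ i)) ⟨
  Σ1 (suc n) (λ i → f (2 + n ∸ i))         ∎
  where open ≡-Reasoning

Σ1-triangle-suc : ∀ n (g : ℕ → ℕ → ℕ) →
  Σ1 (suc n) (λ i → Σ1 (suc n ∸ i) (g i))
    ≡ Σ1 n (λ i → Σ1 (n ∸ i) (g i)) + Σ1 n (λ i → g i (suc n ∸ i))
Σ1-triangle-suc n g = begin
  Σ1 n (λ i → Σ1 (suc n ∸ i) (g i)) + Σ1 (n ∸ n) (g (suc n))
    ≡⟨ cong (λ k → Σ1 n (λ i → Σ1 (suc n ∸ i) (g i)) + Σ1 k (g (suc n))) (n∸n≡0 n) ⟩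
  Σ1 n (λ i → Σ1 (suc n ∸ i) (g i)) + 0
    ≡⟨ +-identityʳ _ ⟩
  Σ1 n (λ i → Σ1 (suc n ∸ i) (g i))
    ≡⟨ Σ1-cong n (λ i _ i≤n → peel i (+-∸-assoc 1 i≤n)) ⟩
  Σ1 n (λ i → Σ1 (n ∸ i) (g i) + g i (suc n ∸ i))
    ≡⟨ Σ1-+ n _ _ ⟩
  Σ1 n (λ i → Σ1 (n ∸ i) (g i)) + Σ1 n (λ i → g i (suc n ∸ i)) ∎
  where
  open ≡-Reasoning
  peel : ∀ i → suc n ∸ i ≡ suc (n ∸ i) → Σ1 (suc n ∸ i) (g i) ≡ Σ1 (n ∸ i) (g i) + g i (suc n ∸ i)
  peel i eq rewrite eq = refl

Σ1-triangle : ∀ n (g : ℕ → ℕ → ℕ) →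
  Σ1 n (λ i → Σ1 (n ∸ i) (g i)) ≡ Σ1 n (λ k → Σ1 (n ∸ k) (λ i → g i k))
Σ1-triangle zero g = refl
Σ1-triangle (suc n) g = begin
  Σ1 (suc n) (λ i → Σ1 (suc n ∸ i) (g i))
    ≡⟨ Σ1-triangle-suc n g ⟩
  Σ1 n (λ i → Σ1 (n ∸ i) (g i)) + Σ1 n (λ i → g i (suc n ∸ i))
    ≡⟨ cong₂ _+_ (Σ1-triangle n g) antidiagonal ⟩
  Σ1 n (λ k → Σ1 (n ∸ k) (λ i → g i k)) + Σ1 n (λ k → g (suc n ∸ k) k)
    ≡⟨ Σ1-triangle-suc n (λ k i → g i k) ⟨
  Σ1 (suc n) (λ k → Σ1 (suc n ∸ k) (λ i → g i k)) ∎
  where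
  open ≡-Reasoning
  antidiagonal : Σ1 n (λ i → g i (suc n ∸ i)) ≡ Σ1 n (λ k → g (suc n ∸ k) k)
  antidiagonal = trans (Σ1-reverse n _)
    (Σ1-cong n (λ k _ k≤n → cong (g (suc n ∸ k)) (m∸[m∸n]≡n (m≤n⇒m≤1+n k≤n))))

-- straddled n: tilings of n + m columns in which the cut after column n lies inside an unbreakable
-- block, the block of columns n-i+1 … n+j contributing R (n ∸ i) * R (m ∸ j) * U (i + j).
module Renewal (R U : ℕ → ℕ) (R-zero : R 0 ≡ 1)
  (R-renewal : ∀ n → 1 ≤ n → R n ≡ Σ1 n (λ k → R (n ∸ k) * U k)) (m : ℕ) where

  straddle : ℕ → ℕ
  straddle i = Σ1 m (λ j → R (m ∸ j) * U (i + j))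

  straddled : ℕ → ℕ
  straddled n = Σ1 n (λ i → Σ1 m (λ j → R (n ∸ i) * R (m ∸ j) * U (i + j)))

  straddled-factor : ∀ n → straddled n ≡ Σ1 n (λ i → R (n ∸ i) * straddle i)
  straddled-factor n = Σ1-cong n (λ i _ _ →
    trans (Σ1-cong m (λ j _ _ → *-assoc (R (n ∸ i)) _ _)) (Σ1-*ˡ m (R (n ∸ i)) _))

  straddled-renewal : ∀ n' → let n = suc n' in
    straddled n ≡ Σ1 n (λ k → straddled (n ∸ k) * U k) + straddle n
  straddled-renewal n' = begin
    straddled n
      ≡⟨ straddled-factor n ⟩
    Σ1 n' (λ i → R (n ∸ i) * straddle i) + R (n' ∸ n') * straddle n
      ≡⟨ cong (λ k → Σ1 n' (λ i → R (n ∸ i) * straddle i) + R k * straddle n) (n∸n≡0 n') ⟩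
    Σ1 n' (λ i → R (n ∸ i) * straddle i) + R 0 * straddle n
      ≡⟨ cong₂ _+_ (Σ1-cong n' (λ i _ i≤n' → expand i i≤n')) (cong (_* straddle n) R-zero) ⟩
    Σ1 n' (λ i → Σ1 (n ∸ i) (g i)) + 1 * straddle n
      ≡⟨ cong₂ _+_ extend (*-identityˡ (straddle n)) ⟩
    Σ1 n (λ i → Σ1 (n ∸ i) (g i)) + straddle n
      ≡⟨ cong (_+ straddle n) (Σ1-triangle n g) ⟩
    Σ1 n (λ k → Σ1 (n ∸ k) (λ i → g i k)) + straddle n
      ≡⟨ cong (_+ straddle n) (Σ1-cong n (λ k _ _ → collect k)) ⟩
    Σ1 n (λ k → straddled (n ∸ k) * U k) + straddle n ∎
    where
    open ≡-Reasoning
    n = suc n'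
    g : ℕ → ℕ → ℕ
    g i k = R (n ∸ i ∸ k) * U k * straddle i
    expand : ∀ i → i ≤ n' → R (n ∸ i) * straddle i ≡ Σ1 (n ∸ i) (g i)
    expand i i≤n' = begin
      R (n ∸ i) * straddle i
        ≡⟨ cong (_* straddle i) (R-renewal (n ∸ i) (subst (1 ≤_) (sym (+-∸-assoc 1 i≤n')) (s≤s z≤n))) ⟩
      Σ1 (n ∸ i) (λ k → R (n ∸ i ∸ k) * U k) * straddle i
        ≡⟨ Σ1-*ʳ (n ∸ i) (straddle i) _ ⟨
      Σ1 (n ∸ i) (g i) ∎
    extend : Σ1 n' (λ i → Σ1 (n ∸ i) (g i)) ≡ Σ1 n (λ i → Σ1 (n ∸ i) (g i))
    extend = sym (trans (cong (λ k → Σ1 n' (λ i → Σ1 (n ∸ i) (g i)) + Σ1 k (g n)) (n∸n≡0 n'))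
                        (+-identityʳ _))
    collect : ∀ k → Σ1 (n ∸ k) (λ i → g i k) ≡ straddled (n ∸ k) * U k
    collect k = begin
      Σ1 (n ∸ k) (λ i → g i k)
        ≡⟨ Σ1-cong (n ∸ k) (λ i _ _ → swap-factors (∸-swap i)) ⟩
      Σ1 (n ∸ k) (λ i → R (n ∸ k ∸ i) * straddle i * U k)
        ≡⟨ Σ1-*ʳ (n ∸ k) (U k) _ ⟩
      Σ1 (n ∸ k) (λ i → R (n ∸ k ∸ i) * straddle i) * U k
        ≡⟨ cong (_* U k) (straddled-factor (n ∸ k)) ⟨
      straddled (n ∸ k) * U k ∎
      where
      ∸-swap : ∀ i → n ∸ i ∸ k ≡ n ∸ k ∸ i
      ∸-swap i = trans (∸-+-assoc n i k) (trans (cong (n ∸_) (+-comm i k)) (sym (∸-+-assoc n k i)))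
      swap-factors : ∀ {i} → n ∸ i ∸ k ≡ n ∸ k ∸ i → g i k ≡ R (n ∸ k ∸ i) * straddle i * U k
      swap-factors {i} eq rewrite eq = *-right-comm (R (n ∸ k ∸ i)) (U k) (straddle i)

  renewal-split : ∀ n → R (n + m) ≡ R n * R m + straddled n
  renewal-split = <-rec _ split
    where
    split : ∀ n → (∀ {n'} → n' < n → R (n' + m) ≡ R n' * R m + straddled n') →
      R (n + m) ≡ R n * R m + straddled n
    split zero _ = sym (trans (+-identityʳ _) (trans (cong (_* R m) R-zero) (*-identityˡ (R m))))
    split n@(suc n') ih = begin
      R (n + m)
        ≡⟨ R-renewal (n + m) (s≤s z≤n) ⟩
      Σ1 (n + m) (λ k → R (n + m ∸ k) * U k)
        ≡⟨ Σ1-+-range n m _ ⟩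
      Σ1 n (λ k → R (n + m ∸ k) * U k) + Σ1 m (λ j → R (n + m ∸ (n + j)) * U (n + j))
        ≡⟨ cong₂ _+_ cut-inside
             (Σ1-cong m (λ j _ _ → cong (λ w → R w * U (n + j)) ([m+n]∸[m+o]≡n∸o n m j))) ⟩
      R n * R m + Σ1 n (λ k → straddled (n ∸ k) * U k) + straddle n
        ≡⟨ +-assoc (R n * R m) _ _ ⟩
      R n * R m + (Σ1 n (λ k → straddled (n ∸ k) * U k) + straddle n)
        ≡⟨ cong (R n * R m +_) (straddled-renewal n') ⟨
      R n * R m + straddled n ∎
      where
      open ≡-Reasoning
      distribute : ∀ x y z w → (x * y + z) * w ≡ x * w * y + z * w
      distribute = solve-∀
      cut-inside : Σ1 n (λ k → R (n + m ∸ k) * U k) ≡ R n * R m + Σ1 n (λ k → straddled (n ∸ k) * U k)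
      cut-inside = begin
        Σ1 n (λ k → R (n + m ∸ k) * U k)
          ≡⟨ Σ1-cong n (λ { (suc k) _ k≤n → trans (cong (λ w → R w * U (suc k)) (+-∸-comm m k≤n))
                 (trans (cong (_* U (suc k)) (ih (s≤s (m∸n≤m n' k))))
                        (distribute (R (n ∸ suc k)) (R m) (straddled (n ∸ suc k)) (U (suc k)))) }) ⟩
        Σ1 n (λ k → R (n ∸ k) * U k * R m + straddled (n ∸ k) * U k)
          ≡⟨ Σ1-+ n _ _ ⟩
        Σ1 n (λ k → R (n ∸ k) * U k * R m) + Σ1 n (λ k → straddled (n ∸ k) * U k)
          ≡⟨ cong (_+ Σ1 n (λ k → straddled (n ∸ k) * U k))
                  (trans (Σ1-*ʳ n (R m) _) (cong (_* R m) (sym (R-renewal n (s≤s z≤n))))) ⟩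
        R n * R m + Σ1 n (λ k → straddled (n ∸ k) * U k) ∎

data Crossing : Set where
  none level₂ level₁ both : Crossing

crossed : Crossing → Bool
crossed none = false
crossed _ = true

Σᶜ : (Crossing → ℕ) → ℕ
Σᶜ f = (f none + f level₂) + (f level₁ + f both)

Σᶜ-cong : {f g : Crossing → ℕ} → (∀ s → f s ≡ g s) → Σᶜ f ≡ Σᶜ g
Σᶜ-cong eq = cong₂ _+_ (cong₂ _+_ (eq none) (eq level₂)) (cong₂ _+_ (eq level₁) (eq both))

Σᶜ-*ˡ : ∀ c (f : Crossing → ℕ) → Σᶜ (λ s → c * f s) ≡ c * Σᶜ f
Σᶜ-*ˡ c f = distrib c (f none) (f level₂) (f level₁) (f both)
  where
  distrib : ∀ c w x y z → (c * w + c * x) + (c * y + c * z) ≡ c * ((w + x) + (y + z))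
  distrib = solve-∀

Σᶜ-none : ∀ (f : Crossing → ℕ) → Σᶜ f ≡ f none + Σᶜ (λ s → ⟦ crossed s ⟧ * f s)
Σᶜ-none f = split (f none) (f level₂) (f level₁) (f both)
  where
  split : ∀ w x y z → (w + x) + (y + z) ≡ w + ((0 * w + 1 * x) + (1 * y + 1 * z))
  split = solve-∀

Σᶜ-Σ1 : ∀ n (f : Crossing → ℕ → ℕ) →
  Σᶜ (λ s → Σ1 n (f s)) ≡ Σ1 n (λ i → Σᶜ (λ s → f s i))
Σᶜ-Σ1 n f = sym (begin
  Σ1 n (λ i → (f none i + f level₂ i) + (f level₁ i + f both i))
    ≡⟨ Σ1-+ n _ _ ⟩
  Σ1 n (λ i → f none i + f level₂ i) + Σ1 n (λ i → f level₁ i + f both i)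
    ≡⟨ cong₂ _+_ (Σ1-+ n _ _) (Σ1-+ n _ _) ⟩
  Σᶜ (λ s → Σ1 n (f s)) ∎)
  where open ≡-Reasoning

Σ⊆-Σᶜ : {A : Set} (xs : List A) (F : Crossing → List A → ℕ) →
  Σ⊆ xs (λ S → Σᶜ (λ s → F s S)) ≡ Σᶜ (λ s → Σ⊆ xs (F s))
Σ⊆-Σᶜ xs F = begin
  Σ⊆ xs (λ S → (F none S + F level₂ S) + (F level₁ S + F both S))
    ≡⟨ Σ⊆-+ xs _ _ ⟩
  Σ⊆ xs (λ S → F none S + F level₂ S) + Σ⊆ xs (λ S → F level₁ S + F both S)
    ≡⟨ cong₂ _+_ (Σ⊆-+ xs _ _) (Σ⊆-+ xs _ _) ⟩
  Σᶜ (λ s → Σ⊆ xs (F s)) ∎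
  where open ≡-Reasoning

-- Z n t: weighted tilings of n columns whose last column emits the crossing dominoes t;
-- Zᵘ n t: the unbreakable ones (Zᵘ 0 is a dummy value).
module TransferMatrix (T : Crossing → Crossing → ℕ) where

  Z : ℕ → Crossing → ℕ
  Z zero t = ⟦ not (crossed t) ⟧
  Z (suc n) t = Σᶜ (λ s → T s t * Z n s)

  Zᵘ : ℕ → Crossing → ℕ
  Zᵘ zero t = 0
  Zᵘ (suc zero) t = T none t
  Zᵘ (suc (suc n)) t = Σᶜ (λ s → ⟦ crossed s ⟧ * (T s t * Zᵘ (suc n) s))

  Z-one : ∀ t → Z 1 t ≡ T none t
  Z-one t = only-none (T none t) (T level₂ t) (T level₁ t) (T both t)
    where
    only-none : ∀ w x y z → (w * 1 + x * 0) + (y * 0 + z * 0) ≡ w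
    only-none = solve-∀

  Z-last-block : ∀ n t → Z (suc n) t ≡ Σ1 (suc n) (λ i → Z (suc n ∸ i) none * Zᵘ i t)
  Z-last-block zero t = trans (Z-one t) (sym (*-identityˡ (T none t)))
  Z-last-block (suc n) t = begin
    Σᶜ (λ s → T s t * Z (suc n) s)
      ≡⟨ Σᶜ-none (λ s → T s t * Z (suc n) s) ⟩
    T none t * Z (suc n) none + Σᶜ (λ s → ⟦ crossed s ⟧ * (T s t * Z (suc n) s))
      ≡⟨ cong₂ _+_ (*-comm (T none t) _)
                   (Σᶜ-cong (λ s → cong (λ x → ⟦ crossed s ⟧ * (T s t * x)) (Z-last-block n s))) ⟩
    Z (suc n) none * T none t + Σᶜ (λ s → ⟦ crossed s ⟧ * (T s t * Σ1 (suc n) (λ i → A i * Zᵘ i s)))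
      ≡⟨ cong (Z (suc n) none * T none t +_) extend-blocks ⟩
    Z (suc n) none * T none t + Σ1 (suc n) (λ i → A i * Zᵘ (suc i) t)
      ≡⟨ Σ1-suc (suc n) (λ i → Z (2 + n ∸ i) none * Zᵘ i t) ⟨
    Σ1 (2 + n) (λ i → Z (2 + n ∸ i) none * Zᵘ i t) ∎
    where
    open ≡-Reasoning
    A : ℕ → ℕ
    A i = Z (suc n ∸ i) none
    rearrange : ∀ c x y w → c * x * (y * w) ≡ y * (c * (x * w))
    rearrange = solve-∀
    extend-blocks : Σᶜ (λ s → ⟦ crossed s ⟧ * (T s t * Σ1 (suc n) (λ i → A i * Zᵘ i s)))
                  ≡ Σ1 (suc n) (λ i → A i * Zᵘ (suc i) t)
    extend-blocks = begin
      Σᶜ (λ s → ⟦ crossed s ⟧ * (T s t * Σ1 (suc n) (λ i → A i * Zᵘ i s)))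
        ≡⟨ Σᶜ-cong (λ s → trans (sym (*-assoc ⟦ crossed s ⟧ (T s t) (Σ1 (suc n) (λ i → A i * Zᵘ i s))))
             (trans (sym (Σ1-*ˡ (suc n) (⟦ crossed s ⟧ * T s t) (λ i → A i * Zᵘ i s)))
               (Σ1-cong (suc n) (λ i _ _ → rearrange ⟦ crossed s ⟧ (T s t) (A i) (Zᵘ i s))))) ⟩
      Σᶜ (λ s → Σ1 (suc n) (λ i → A i * (⟦ crossed s ⟧ * (T s t * Zᵘ i s))))
        ≡⟨ Σᶜ-Σ1 (suc n) (λ s i → A i * (⟦ crossed s ⟧ * (T s t * Zᵘ i s))) ⟩
      Σ1 (suc n) (λ i → Σᶜ (λ s → A i * (⟦ crossed s ⟧ * (T s t * Zᵘ i s))))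
        ≡⟨ Σ1-cong (suc n) (λ { (suc i) _ _ →
             Σᶜ-*ˡ (A (suc i)) (λ s → ⟦ crossed s ⟧ * (T s t * Zᵘ (suc i) s)) }) ⟩
      Σ1 (suc n) (λ i → A i * Zᵘ (suc i) t) ∎

  Z-renewal : ∀ n → 1 ≤ n → Z n none ≡ Σ1 n (λ k → Z (n ∸ k) none * Zᵘ k none)
  Z-renewal (suc n) _ = Z-last-block n none

<ᵇ-true : ∀ {m n} → m < n → (m <ᵇ n) ≡ true
<ᵇ-true {zero} {suc n} _ = refl
<ᵇ-true {suc m} {suc n} (s≤s m<n) = <ᵇ-true m<n

<ᵇ-false : ∀ {m n} → n ≤ m → (m <ᵇ n) ≡ false
<ᵇ-false {m} {zero} _ = refl
<ᵇ-false {suc m} {suc n} (s≤s n≤m) = <ᵇ-false n≤m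

≡ᵇ-refl : ∀ n → (n ≡ᵇ n) ≡ true
≡ᵇ-refl zero = refl
≡ᵇ-refl (suc n) = ≡ᵇ-refl n

∧≡true⁻ : ∀ {a b} → a ∧ b ≡ true → a ≡ true × b ≡ true
∧≡true⁻ {true} {true} _ = refl , refl

≡ᵇ-< : ∀ {m n} → m < n → (m ≡ᵇ n) ≡ false
≡ᵇ-< {zero} {suc n} _ = refl
≡ᵇ-< {suc m} {suc n} (s≤s m<n) = ≡ᵇ-< m<n

sqEq-false⇒≢ : ∀ {x y} → sqEq x y ≡ false → x ≢ y
sqEq-false⇒≢ {j , k} eq refl with trans (sym eq) (cong₂ _∧_ (≡ᵇ-refl j) (≡ᵇ-refl k))
... | ()

disjoint⇒≢ : ∀ x y u v → disjoint (x , y) (u , v) ≡ true → x ≢ u × x ≢ v × y ≢ u × y ≢ v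
disjoint⇒≢ x y u v eq with sqEq x u in xu | sqEq x v in xv | sqEq y u in yu | sqEq y v in yv | eq
... | false | false | false | false | _ =
  sqEq-false⇒≢ xu , sqEq-false⇒≢ xv , sqEq-false⇒≢ yu , sqEq-false⇒≢ yv

module _ {A : Set} where

  allᵇ-++ : (f : A → Bool) (xs ys : List A) → allᵇ f (xs ++ ys) ≡ allᵇ f xs ∧ allᵇ f ys
  allᵇ-++ f [] ys = refl
  allᵇ-++ f (x ∷ xs) ys = trans (cong (f x ∧_) (allᵇ-++ f xs ys)) (sym (∧-assoc (f x) _ _))

  anyᵇ-++ : (f : A → Bool) (xs ys : List A) → anyᵇ f (xs ++ ys) ≡ anyᵇ f xs ∨ anyᵇ f ys
  anyᵇ-++ f [] ys = refl
  anyᵇ-++ f (x ∷ xs) ys with f x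
  ... | true = refl
  ... | false = anyᵇ-++ f xs ys

  allᵇ-congᴬ : {f g : A → Bool} (xs : List A) → All (λ x → f x ≡ g x) xs → allᵇ f xs ≡ allᵇ g xs
  allᵇ-congᴬ [] [] = refl
  allᵇ-congᴬ (x ∷ xs) (eq ∷ eqs) = cong₂ _∧_ eq (allᵇ-congᴬ xs eqs)

  allᵇ-true : {f : A → Bool} (xs : List A) → All (λ x → f x ≡ true) xs → allᵇ f xs ≡ true
  allᵇ-true [] [] = refl
  allᵇ-true (x ∷ xs) (eq ∷ eqs) rewrite eq = allᵇ-true xs eqs

  anyᵇ-false : {f : A → Bool} (xs : List A) → All (λ x → f x ≡ false) xs → anyᵇ f xs ≡ false
  anyᵇ-false [] [] = refl
  anyᵇ-false (x ∷ xs) (eq ∷ eqs) rewrite eq = anyᵇ-false xs eqs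

  concatMap-congᴬ : {B : Set} {f g : A → List B} (xs : List A) → All (λ x → f x ≡ g x) xs →
    concatMap f xs ≡ concatMap g xs
  concatMap-congᴬ [] [] = refl
  concatMap-congᴬ (x ∷ xs) (eq ∷ eqs) = cong₂ _++_ eq (concatMap-congᴬ xs eqs)

  Unique-⊆⇒length≤ : {xs ys : List A} → Unique xs → xs ⊆ ys → length xs ≤ length ys
  Unique-⊆⇒length≤ {[]} _ _ = z≤n
  Unique-⊆⇒length≤ {x ∷ xs} (x∉xs ∷ unique) xs⊆ys with ∈-∃++ (xs⊆ys (here refl))
  ... | us , vs , refl = begin
    suc (length xs)         ≤⟨ s≤s (Unique-⊆⇒length≤ unique remove-x) ⟩
    suc (length (us ++ vs)) ≡⟨ cong suc (length-++ us) ⟩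
    suc (length us + length vs) ≡⟨ +-suc (length us) (length vs) ⟨
    length us + suc (length vs) ≡⟨ length-++ us ⟨
    length (us ++ x ∷ vs) ∎
    where
    open ≤-Reasoning
    remove-x : xs ⊆ us ++ vs
    remove-x {y} y∈xs with ∈-++⁻ us (xs⊆ys (there y∈xs))
    ... | inj₁ y∈us = ∈-++⁺ˡ y∈us
    ... | inj₂ (here refl) = contradiction refl (All.lookup x∉xs y∈xs)
    ... | inj₂ (there y∈vs) = ∈-++⁺ʳ us y∈vs

  Disjoint-⊆ : {xs xs' ys ys' : List A} → xs' ⊆ xs → ys' ⊆ ys → Disjoint xs ys → Disjoint xs' ys'
  Disjoint-⊆ sub sub' disj (v∈xs' , v∈ys') = disj (sub v∈xs' , sub' v∈ys')

  Disjoint-++ʳ : {xs ys zs : List A} → Disjoint xs ys → Disjoint xs zs → Disjoint xs (ys ++ zs)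
  Disjoint-++ʳ {ys = ys} d d' (v∈xs , v∈ys++zs) with ∈-++⁻ ys v∈ys++zs
  ... | inj₁ v∈ys = d (v∈xs , v∈ys)
  ... | inj₂ v∈zs = d' (v∈xs , v∈zs)

allDisjoint : List Edge → List Edge → Bool
allDisjoint S T = allᵇ (λ e → allᵇ (disjoint e) T) S

allDisjoint-[] : ∀ S → allDisjoint S [] ≡ true
allDisjoint-[] [] = refl
allDisjoint-[] (e ∷ S) = allDisjoint-[] S

allDisjoint-++ʳ : ∀ S T U → allDisjoint S (T ++ U) ≡ allDisjoint S T ∧ allDisjoint S U
allDisjoint-++ʳ [] T U = refl
allDisjoint-++ʳ (e ∷ S) T U = trans (cong₂ _∧_ (allᵇ-++ (disjoint e) T U) (allDisjoint-++ʳ S T U))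
  (∧-interchange (allᵇ (disjoint e) T) (allᵇ (disjoint e) U) (allDisjoint S T) _)

isMatching-++ : ∀ S T → isMatching (S ++ T) ≡ isMatching S ∧ (isMatching T ∧ allDisjoint S T)
isMatching-++ [] T = sym (∧-identityʳ (isMatching T))
isMatching-++ (e ∷ S) T = begin
  allᵇ (disjoint e) (S ++ T) ∧ isMatching (S ++ T)
    ≡⟨ cong₂ _∧_ (allᵇ-++ (disjoint e) S T) (isMatching-++ S T) ⟩
  (allᵇ (disjoint e) S ∧ allᵇ (disjoint e) T) ∧ (isMatching S ∧ (isMatching T ∧ allDisjoint S T))
    ≡⟨ ∧-interchange (allᵇ (disjoint e) S) (allᵇ (disjoint e) T) (isMatching S) _ ⟩
  (allᵇ (disjoint e) S ∧ isMatching S) ∧ (allᵇ (disjoint e) T ∧ (isMatching T ∧ allDisjoint S T))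
    ≡⟨ cong ((allᵇ (disjoint e) S ∧ isMatching S) ∧_)
            (∧-left-comm (allᵇ (disjoint e) T) (isMatching T) (allDisjoint S T)) ⟩
  (allᵇ (disjoint e) S ∧ isMatching S) ∧ (isMatching T ∧ (allᵇ (disjoint e) T ∧ allDisjoint S T)) ∎
  where open ≡-Reasoning

Ends : (Square → Set) → Edge → Set
Ends P (u , v) = P u × P v

Columns≤ Columns≥ : ℕ → Edge → Set
Columns≤ k = Ends (λ x → proj₁ x ≤ k)
Columns≥ k = Ends (λ x → k ≤ proj₁ x)

Columns≥-≤ : ∀ {i k} e → i ≤ k → Columns≥ k e → Columns≥ i e
Columns≥-≤ ((_ , _) , (_ , _)) i≤k (k≤c , k≤c') = ≤-trans i≤k k≤c , ≤-trans i≤k k≤c'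

squaresOf : List Edge → List Square
squaresOf = concatMap (λ e → proj₁ e ∷ proj₂ e ∷ [])

length-squaresOf : ∀ S → length (squaresOf S) ≡ 2 * length S
length-squaresOf [] = refl
length-squaresOf (e ∷ S) = trans (cong (2 +_) (length-squaresOf S)) (sym (*-distribˡ-+ 2 1 (length S)))

squaresOf-All : ∀ {P} S → All (Ends P) S → All P (squaresOf S)
squaresOf-All [] [] = []
squaresOf-All ((u , v) ∷ S) ((pu , pv) ∷ ps) = pu ∷ pv ∷ squaresOf-All S ps

map-proj₁⊆squaresOf : ∀ S → map proj₁ S ⊆ squaresOf S
map-proj₁⊆squaresOf (e ∷ S) (here refl) = here refl
map-proj₁⊆squaresOf (e ∷ S) (there x∈) = there (there (map-proj₁⊆squaresOf S x∈))

map-proj₂⊆squaresOf : ∀ S → map proj₂ S ⊆ squaresOf S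
map-proj₂⊆squaresOf (e ∷ S) (here refl) = there (here refl)
map-proj₂⊆squaresOf (e ∷ S) (there x∈) = there (there (map-proj₂⊆squaresOf S x∈))

ends-apart : ∀ x y S → allᵇ (disjoint (x , y)) S ≡ true →
  All (x ≢_) (squaresOf S) × All (y ≢_) (squaresOf S)
ends-apart x y [] _ = [] , []
ends-apart x y ((u , v) ∷ S) eq with ∧≡true⁻ eq
... | d , ds with disjoint⇒≢ x y u v d | ends-apart x y S ds
... | x≢u , x≢v , y≢u , y≢v | x≢ , y≢ = (x≢u ∷ x≢v ∷ x≢) , (y≢u ∷ y≢v ∷ y≢)

squaresOf-Unique : ∀ S → All (λ e → proj₁ e ≢ proj₂ e) S → isMatching S ≡ true → Unique (squaresOf S)
squaresOf-Unique [] [] _ = []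
squaresOf-Unique ((x , y) ∷ S) (x≢y ∷ proper) eq with ∧≡true⁻ eq
... | d , matching with ends-apart x y S d
... | x≢ , y≢ = (x≢y ∷ x≢) ∷ y≢ ∷ squaresOf-Unique S proper matching

squaresOf-Disjoint : ∀ S T → allDisjoint S T ≡ true → Disjoint (squaresOf S) (squaresOf T)
squaresOf-Disjoint ((x , y) ∷ S) T eq {v} (v∈S , v∈T) with ∧≡true⁻ eq
... | d , ds with ends-apart x y T d | v∈S
... | x≢ , _ | here refl = All.lookup x≢ v∈T refl
... | _ , y≢ | there (here refl) = All.lookup y≢ v∈T refl
... | _ | there (there v∈S') = squaresOf-Disjoint S T ds (v∈S' , v∈T)

disjoint-separated : ∀ {k} e f → Columns≤ k e → Columns≥ (suc k) f → disjoint e f ≡ true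
disjoint-separated ((i , _) , (i' , _)) ((j , _) , (j' , _)) (i≤k , i'≤k) (k<j , k<j')
  rewrite ≡ᵇ-< (≤-trans (s≤s i≤k) k<j) | ≡ᵇ-< (≤-trans (s≤s i≤k) k<j')
        | ≡ᵇ-< (≤-trans (s≤s i'≤k) k<j) | ≡ᵇ-< (≤-trans (s≤s i'≤k) k<j') = refl

allDisjoint-separated : ∀ {k} S T → All (Columns≤ k) S → All (Columns≥ (suc k)) T → allDisjoint S T ≡ true
allDisjoint-separated S T cS cT =
  allᵇ-true S (All.map (λ {e} ce → allᵇ-true T (All.map (λ {f} cf → disjoint-separated e f ce cf) cT)) cS)

crosses-left : ∀ {i} e → Columns≤ i e → crosses (suc i) e ≡ false
crosses-left ((j , _) , (j' , _)) (j≤i , j'≤i) rewrite <ᵇ-true (s≤s j≤i) | <ᵇ-true (s≤s j'≤i) = refl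

crosses-right : ∀ {i} e → Columns≥ i e → crosses i e ≡ false
crosses-right ((j , _) , (j' , _)) (i≤j , i≤j') rewrite <ᵇ-false i≤j | <ᵇ-false i≤j' = refl

unbreakable-anyᵇ : ∀ n M → unbreakable n M ≡ allᵇ (λ i → anyᵇ (crosses (suc i)) M) (upTo (n ∸ 1))
unbreakable-anyᵇ n M =
  allᵇ-congᴬ (upTo (n ∸ 1)) (All.tabulate (λ {i} _ → not-involutive (anyᵇ (crosses (suc i)) M)))

unbreakable-split : ∀ k S C T → All (Columns≤ k) S → All (Columns≥ k) C → All (Columns≥ (suc k)) T →
  unbreakable (2 + k) (S ++ (C ++ T)) ≡ unbreakable (suc k) S ∧ anyᵇ (crosses (suc k)) C
unbreakable-split k S C T cS cC cT = begin
  unbreakable (2 + k) M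
    ≡⟨ unbreakable-anyᵇ (2 + k) M ⟩
  allᵇ (cut M) (upTo (suc k))
    ≡⟨ cong (allᵇ (cut M)) (upTo-∷ʳ k) ⟨
  allᵇ (cut M) (upTo k ++ k ∷ [])
    ≡⟨ allᵇ-++ (cut M) (upTo k) (k ∷ []) ⟩
  allᵇ (cut M) (upTo k) ∧ (cut M k ∧ true)
    ≡⟨ cong₂ (λ x y → x ∧ (y ∧ true))
             (allᵇ-congᴬ (upTo k) (All.tabulate (earlier-cut ∘ ∈-upTo⁻))) last-cut ⟩
  allᵇ (cut S) (upTo k) ∧ (anyᵇ (crosses (suc k)) C ∧ true)
    ≡⟨ cong₂ _∧_ (sym (unbreakable-anyᵇ (suc k) S)) (∧-identityʳ _) ⟩
  unbreakable (suc k) S ∧ anyᵇ (crosses (suc k)) C ∎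
  where
  open ≡-Reasoning
  M = S ++ (C ++ T)
  cut : List Edge → ℕ → Bool
  cut L i = anyᵇ (crosses (suc i)) L
  cut-++ : ∀ i → cut M i ≡ cut S i ∨ (cut C i ∨ cut T i)
  cut-++ i = trans (anyᵇ-++ (crosses (suc i)) S (C ++ T)) (cong (cut S i ∨_) (anyᵇ-++ (crosses (suc i)) C T))
  earlier-cut : ∀ {i} → i < k → cut M i ≡ cut S i
  earlier-cut {i} i<k
    rewrite cut-++ i
          | anyᵇ-false C (All.map (λ {e} → crosses-right e ∘ Columns≥-≤ e i<k) cC)
          | anyᵇ-false T (All.map (λ {e} → crosses-right e ∘ Columns≥-≤ e (m≤n⇒m≤1+n i<k)) cT)
    = ∨-identityʳ (cut S i)
  last-cut : cut M k ≡ cut C k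
  last-cut
    rewrite cut-++ k
          | anyᵇ-false S (All.map (λ {e} → crosses-left e) cS)
          | anyᵇ-false T (All.map (λ {e} → crosses-right e) cT)
    = ∨-identityʳ (cut C k)

avoiding : List Edge → List Edge → Bool
avoiding S D = isMatching S ∧ allDisjoint S D

avoiding-split : ∀ S C T D → allDisjoint S T ≡ true → allDisjoint S D ≡ true →
  avoiding (S ++ (C ++ T)) D ≡ avoiding S C ∧ avoiding (C ++ T) D
avoiding-split S C T D apartT apartD = begin
  isMatching (S ++ M) ∧ allDisjoint (S ++ M) D
    ≡⟨ cong₂ _∧_ (isMatching-++ S M) (allᵇ-++ _ S M) ⟩
  (isMatching S ∧ (isMatching M ∧ allDisjoint S M)) ∧ (allDisjoint S D ∧ allDisjoint M D)
    ≡⟨ cong₂ (λ x y → (isMatching S ∧ (isMatching M ∧ x)) ∧ (y ∧ allDisjoint M D))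
             (trans (allDisjoint-++ʳ S C T) (cong (allDisjoint S C ∧_) apartT)) apartD ⟩
  (isMatching S ∧ (isMatching M ∧ (allDisjoint S C ∧ true))) ∧ allDisjoint M D
    ≡⟨ cong (λ x → (isMatching S ∧ x) ∧ allDisjoint M D)
            (trans (cong (isMatching M ∧_) (∧-identityʳ _)) (∧-comm (isMatching M) _)) ⟩
  (isMatching S ∧ (allDisjoint S C ∧ isMatching M)) ∧ allDisjoint M D
    ≡⟨ cong (_∧ allDisjoint M D) (∧-assoc (isMatching S) _ _) ⟨
  ((isMatching S ∧ allDisjoint S C) ∧ isMatching M) ∧ allDisjoint M D
    ≡⟨ ∧-assoc (avoiding S C) _ _ ⟩
  avoiding S C ∧ avoiding M D ∎
  where
  open ≡-Reasoning
  M = C ++ T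

avoiding-++⁻ : ∀ C S D → avoiding (C ++ S) D ≡ true →
  isMatching S ≡ true × allDisjoint C S ≡ true × allDisjoint C D ≡ true × allDisjoint S D ≡ true
avoiding-++⁻ C S D avoid
  with matching , apart ← ∧≡true⁻ avoid
  with _ , matching-apart ← ∧≡true⁻ {isMatching C} (trans (sym (isMatching-++ C S)) matching)
     | apartCD , apartSD ← ∧≡true⁻ {allDisjoint C D} (trans (sym (allᵇ-++ _ C S)) apart)
  with matchingS , apartCS ← ∧≡true⁻ matching-apart
  = matchingS , apartCS , apartCD , apartSD

shift : ℕ → Edge → Edge
shift k ((c , r) , (c' , r')) = ((c + k , r) , (c' + k , r'))

≡ᵇ-+ʳ : ∀ k m n → ((m + k) ≡ᵇ (n + k)) ≡ (m ≡ᵇ n)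
≡ᵇ-+ʳ k m n rewrite +-comm m k | +-comm n k = cancel k
  where
  cancel : ∀ k → ((k + m) ≡ᵇ (k + n)) ≡ (m ≡ᵇ n)
  cancel zero = refl
  cancel (suc k) = cancel k

disjoint-shift : ∀ k e f → disjoint (shift k e) (shift k f) ≡ disjoint e f
disjoint-shift k ((c₁ , _) , (c₂ , _)) ((c₃ , _) , (c₄ , _))
  rewrite ≡ᵇ-+ʳ k c₁ c₃ | ≡ᵇ-+ʳ k c₁ c₄ | ≡ᵇ-+ʳ k c₂ c₃ | ≡ᵇ-+ʳ k c₂ c₄ = refl

allᵇ-disjoint-shift : ∀ k e T → allᵇ (disjoint (shift k e)) (map (shift k) T) ≡ allᵇ (disjoint e) T
allᵇ-disjoint-shift k e [] = refl
allᵇ-disjoint-shift k e (f ∷ T) = cong₂ _∧_ (disjoint-shift k e f) (allᵇ-disjoint-shift k e T)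

avoiding-shift : ∀ k S D → avoiding (map (shift k) S) (map (shift k) D) ≡ avoiding S D
avoiding-shift k S D = cong₂ _∧_ (isMatching-shift S) (allDisjoint-shift S)
  where
  isMatching-shift : ∀ S → isMatching (map (shift k) S) ≡ isMatching S
  isMatching-shift [] = refl
  isMatching-shift (e ∷ S) = cong₂ _∧_ (allᵇ-disjoint-shift k e S) (isMatching-shift S)
  allDisjoint-shift : ∀ S → allDisjoint (map (shift k) S) (map (shift k) D) ≡ allDisjoint S D
  allDisjoint-shift [] = refl
  allDisjoint-shift (e ∷ S) = cong₂ _∧_ (allᵇ-disjoint-shift k e D) (allDisjoint-shift S)

module Board (p : ℕ) where

  q L : ℕ
  q = 4 + p
  L = 2 + p

  Cell : (ℕ → Set) → Square → Set
  Cell C (c , r) = C c × r < L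

  Cell-map : ∀ {C C' : ℕ → Set} x → (∀ {c} → C c → C' c) → Cell C x → Cell C' x
  Cell-map (_ , _) f (c , r) = f c , r

  Domino : (ℕ → Set) → Edge → Set
  Domino C e = Ends (Cell C) e × proj₁ e ≢ proj₂ e

  Domino-map : ∀ {C C' : ℕ → Set} e → (∀ {c} → C c → C' c) → Domino C e → Domino C' e
  Domino-map ((_ , _) , (_ , _)) f (((c , r) , (c' , r')) , u≢v) = ((f c , r) , (f c' , r')) , u≢v

  Domino⇒Columns≤ : ∀ {k} e → Domino (_≤ k) e → Columns≤ k e
  Domino⇒Columns≤ ((_ , _) , (_ , _)) (((c≤k , _) , (c'≤k , _)) , _) = c≤k , c'≤k

  Domino⇒Columns≥ : ∀ {k} e → Domino (_≡ k) e → Columns≥ k e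
  Domino⇒Columns≥ ((_ , _) , (_ , _)) (((refl , _) , (refl , _)) , _) = ≤-refl , ≤-refl

  columnEdges-Domino : ∀ j → All (Domino (_≡ j)) (columnEdges q j)
  columnEdges-Domino j = (((refl , s≤s z≤n) , (refl , s≤s (s≤s z≤n))) , (λ ()))
    ∷ All.map⁺ (All.tabulate (λ i∈ → path-edge (∈-upTo⁻ i∈)))
    where
    path-edge : ∀ {i} → i < p → Domino (_≡ j) ((j , suc i) , (j , suc (suc i)))
    path-edge i<p = ((refl , s≤s (m≤n⇒m≤1+n i<p)) , (refl , s≤s (s≤s i<p))) , (λ ())

  crossEdges-Domino : ∀ k → All (Domino (_≤ suc k)) (crossEdges q k)
  crossEdges-Domino k = (((n≤1+n k , s≤s z≤n) , (≤-refl , s≤s z≤n)) , (λ ()))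
                      ∷ (((n≤1+n k , ≤-refl) , (≤-refl , s≤s (s≤s z≤n))) , (λ ()))
                      ∷ []

  completeBlocks : ℕ → List Edge
  completeBlocks k = concatMap (λ j → columnEdges q j ++ crossEdges q j) (upTo k)

  completeBlocks-suc : ∀ k → completeBlocks (suc k) ≡ completeBlocks k ++ (columnEdges q k ++ crossEdges q k)
  completeBlocks-suc k = begin
    concatMap block (upTo (suc k))            ≡⟨ cong (concatMap block) (upTo-∷ʳ k) ⟨
    concatMap block (upTo k ++ k ∷ [])        ≡⟨ concatMap-++ block (upTo k) (k ∷ []) ⟩
    completeBlocks k ++ (block k ++ [])       ≡⟨ cong (completeBlocks k ++_) (++-identityʳ (block k)) ⟩
    completeBlocks k ++ block k               ∎
    where
    open ≡-Reasoning
    block : ℕ → List Edge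
    block j = columnEdges q j ++ crossEdges q j

  boardEdges-blocks : ∀ k → boardEdges q (suc k) ≡ completeBlocks k ++ columnEdges q k
  boardEdges-blocks k = begin
    concatMap block (upTo (suc k))              ≡⟨ cong (concatMap block) (upTo-∷ʳ k) ⟨
    concatMap block (upTo k ++ k ∷ [])          ≡⟨ concatMap-++ block (upTo k) (k ∷ []) ⟩
    concatMap block (upTo k) ++ (block k ++ [])
      ≡⟨ cong₂ _++_ (concatMap-congᴬ (upTo k) (All.tabulate (inner-block ∘ ∈-upTo⁻)))
                    (trans (++-identityʳ (block k)) last-block) ⟩
    completeBlocks k ++ columnEdges q k         ∎
    where
    open ≡-Reasoning
    block : ℕ → List Edge
    block j = columnEdges q j ++ (if suc j <ᵇ suc k then crossEdges q j else [])
    inner-block : ∀ {j} → j < k → block j ≡ columnEdges q j ++ crossEdges q j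
    inner-block {j} j<k = cong (λ c → columnEdges q j ++ (if c then crossEdges q j else [])) (<ᵇ-true (s≤s j<k))
    last-block : block k ≡ columnEdges q k
    last-block = trans
      (cong (λ c → columnEdges q k ++ (if c then crossEdges q k else [])) (<ᵇ-false {k} {k} ≤-refl))
                       (++-identityʳ (columnEdges q k))

  boardEdges-one : boardEdges q 1 ≡ columnEdges q 0
  boardEdges-one = boardEdges-blocks 0

  boardEdges-suc : ∀ k → boardEdges q (2 + k) ≡ boardEdges q (suc k) ++ (crossEdges q k ++ columnEdges q (suc k))
  boardEdges-suc k = begin
    boardEdges q (2 + k)
      ≡⟨ trans (boardEdges-blocks (suc k)) (cong (_++ columnEdges q (suc k)) (completeBlocks-suc k)) ⟩
    (completeBlocks k ++ (columnEdges q k ++ crossEdges q k)) ++ columnEdges q (suc k)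
      ≡⟨ ++-assoc (completeBlocks k) _ _ ⟩
    completeBlocks k ++ ((columnEdges q k ++ crossEdges q k) ++ columnEdges q (suc k))
      ≡⟨ cong (completeBlocks k ++_) (++-assoc (columnEdges q k) _ _) ⟩
    completeBlocks k ++ (columnEdges q k ++ (crossEdges q k ++ columnEdges q (suc k)))
      ≡⟨ ++-assoc (completeBlocks k) _ _ ⟨
    (completeBlocks k ++ columnEdges q k) ++ (crossEdges q k ++ columnEdges q (suc k))
      ≡⟨ cong (_++ (crossEdges q k ++ columnEdges q (suc k))) (boardEdges-blocks k) ⟨
    boardEdges q (suc k) ++ (crossEdges q k ++ columnEdges q (suc k)) ∎
    where open ≡-Reasoning

  boardEdges-Domino : ∀ k → All (Domino (_≤ k)) (boardEdges q (suc k))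
  boardEdges-Domino zero = subst (All (Domino (_≤ 0))) (sym boardEdges-one)
    (All.map (λ {e} → Domino-map {_≡ 0} {_≤ 0} e ≤-reflexive) (columnEdges-Domino 0))
  boardEdges-Domino (suc k) = subst (All (Domino (_≤ suc k))) (sym (boardEdges-suc k))
    (All.++⁺ (All.map (λ {e} → Domino-map {_≤ k} {_≤ suc k} e m≤n⇒m≤1+n) (boardEdges-Domino k))
      (All.++⁺ (crossEdges-Domino k)
        (All.map (λ {e} → Domino-map {_≡ suc k} {_≤ suc k} e ≤-reflexive) (columnEdges-Domino (suc k)))))

  -- level₁ is the first-level domino S_{k+1}S_{k+2}, level₂ the second-level domino ending in E_{k+2};
  -- the constructors follow the enumeration order of the sublists of crossEdges.
  crossing : ℕ → Crossing → List Edge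
  crossing k none = []
  crossing k level₂ = ((k , suc p) , (suc k , 1)) ∷ []
  crossing k level₁ = ((k , 0) , (suc k , 0)) ∷ []
  crossing k both = ((k , 0) , (suc k , 0)) ∷ ((k , suc p) , (suc k , 1)) ∷ []

  Σ⊆-crossEdges : ∀ k (F : List Edge → ℕ) → Σ⊆ (crossEdges q k) F ≡ Σᶜ (F ∘ crossing k)
  Σ⊆-crossEdges k F = refl

  crossing-Columns≥ : ∀ k s → All (Columns≥ k) (crossing k s)
  crossing-Columns≥ k none = []
  crossing-Columns≥ k level₂ = (≤-refl , n≤1+n k) ∷ []
  crossing-Columns≥ k level₁ = (≤-refl , n≤1+n k) ∷ []
  crossing-Columns≥ k both = (≤-refl , n≤1+n k) ∷ (≤-refl , n≤1+n k) ∷ []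

  crossing-crosses : ∀ k s → anyᵇ (crosses (suc k)) (crossing k s) ≡ crossed s
  crossing-crosses k none = refl
  crossing-crosses k level₂ rewrite <ᵇ-true (n<1+n k) | <ᵇ-false {k} {k} ≤-refl = refl
  crossing-crosses k level₁ rewrite <ᵇ-true (n<1+n k) | <ᵇ-false {k} {k} ≤-refl = refl
  crossing-crosses k both rewrite <ᵇ-true (n<1+n k) | <ᵇ-false {k} {k} ≤-refl = refl

  crossing-left : ∀ k s → All (Cell (_≡ k)) (map proj₁ (crossing k s)) × Unique (map proj₁ (crossing k s))
  crossing-left k none = [] , []
  crossing-left k level₂ = ((refl , ≤-refl) ∷ []) , ([] ∷ [])
  crossing-left k level₁ = ((refl , s≤s z≤n) ∷ []) , ([] ∷ [])
  crossing-left k both = ((refl , s≤s z≤n) ∷ (refl , ≤-refl) ∷ []) , (((λ ()) ∷ []) ∷ [] ∷ [])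

  crossing-right : ∀ k s →
    All (Cell (_≡ suc k)) (map proj₂ (crossing k s)) × Unique (map proj₂ (crossing k s))
  crossing-right k none = [] , []
  crossing-right k level₂ = ((refl , s≤s (s≤s z≤n)) ∷ []) , ([] ∷ [])
  crossing-right k level₁ = ((refl , s≤s z≤n) ∷ []) , ([] ∷ [])
  crossing-right k both = ((refl , s≤s z≤n) ∷ (refl , s≤s (s≤s z≤n)) ∷ []) , (((λ ()) ∷ []) ∷ [] ∷ [])

  crossing-shift : ∀ j k s → crossing (j + k) s ≡ map (shift k) (crossing j s)
  crossing-shift j k none = refl
  crossing-shift j k level₂ = refl
  crossing-shift j k level₁ = refl
  crossing-shift j k both = refl

  columnEdges-shift : ∀ j k → columnEdges q (j + k) ≡ map (shift k) (columnEdges q j)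
  columnEdges-shift j k = cong (_ ∷_) (map-∘ (upTo p))

  rectangle : List ℕ → List Square
  rectangle cols = cartesianProduct cols (upTo L)

  length-rectangle : ∀ cols → length (rectangle cols) ≡ length cols * L
  length-rectangle [] = refl
  length-rectangle (c ∷ cols) = trans (length-++ (map (c ,_) (upTo L)))
    (cong₂ _+_ (trans (length-map (c ,_) (upTo L)) (length-upTo L)) (length-rectangle cols))

  cells-bound : ∀ cols {xs} → Unique xs → All (Cell (_∈ cols)) xs → length xs ≤ length cols * L
  cells-bound cols {xs} unique cells =
    ≤-trans (Unique-⊆⇒length≤ unique inside) (≤-reflexive (length-rectangle cols))
    where
    inside : xs ⊆ rectangle cols
    inside {c , r} x∈xs with All.lookup cells x∈xs
    ... | c∈cols , r<L = ∈-cartesianProduct⁺ c∈cols (∈-upTo⁺ r<L)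

  prefix-bound : ∀ k s S → All (Domino (_≤ k)) S → avoiding S (crossing k s) ≡ true →
    2 * length S + length (crossing k s) ≤ suc k * L
  prefix-bound k s S dominoes avoid with matching , apart ← ∧≡true⁻ avoid = begin
    2 * length S + length C
      ≡⟨ cong₂ _+_ (length-squaresOf S) (length-map proj₁ C) ⟨
    length (squaresOf S) + length (map proj₁ C)
      ≡⟨ length-++ (squaresOf S) ⟨
    length xs
      ≤⟨ cells-bound (upTo (suc k)) unique cells ⟩
    length (upTo (suc k)) * L
      ≡⟨ cong (_* L) (length-upTo (suc k)) ⟩
    suc k * L ∎
    where
    open ≤-Reasoning
    C = crossing k s
    xs = squaresOf S ++ map proj₁ C
    unique : Unique xs
    unique = Unique.++⁺ (squaresOf-Unique S (All.map proj₂ dominoes) matching) (proj₂ (crossing-left k s))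
      (Disjoint-⊆ id (map-proj₁⊆squaresOf C) (squaresOf-Disjoint S C apart))
    cells : All (Cell (_∈ upTo (suc k))) xs
    cells = All.++⁺
      (All.map (λ {x} → Cell-map {_≤ k} {_∈ upTo (suc k)} x (λ c≤k → ∈-upTo⁺ (s≤s c≤k)))
               (squaresOf-All {Cell (_≤ k)} S (All.map proj₁ dominoes)))
      (All.map (λ {x} → Cell-map {_≡ k} {_∈ upTo (suc k)} x (λ { refl → ∈-upTo⁺ ≤-refl }))
               (proj₁ (crossing-left k s)))

  column-bound : ∀ k s t S → All (Domino (_≡ suc k)) S →
    avoiding (crossing k s ++ S) (crossing (suc k) t) ≡ true →
    length (crossing k s) + (2 * length S + length (crossing (suc k) t)) ≤ L
  column-bound k s t S dominoes avoid
    with matching , apartCS , apartCD , apartSD ← avoiding-++⁻ (crossing k s) S (crossing (suc k) t) avoid = begin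
    length C + (2 * length S + length D)
      ≡⟨ cong₂ _+_ (length-map proj₂ C) (cong₂ _+_ (length-squaresOf S) (length-map proj₁ D)) ⟨
    length (map proj₂ C) + (length (squaresOf S) + length (map proj₁ D))
      ≡⟨ trans (length-++ (map proj₂ C)) (cong (length (map proj₂ C) +_) (length-++ (squaresOf S))) ⟨
    length xs
      ≤⟨ cells-bound (suc k ∷ []) unique cells ⟩
    1 * L
      ≡⟨ *-identityˡ L ⟩
    L ∎
    where
    open ≤-Reasoning
    C = crossing k s
    D = crossing (suc k) t
    xs = map proj₂ C ++ (squaresOf S ++ map proj₁ D)
    unique : Unique xs
    unique = Unique.++⁺ (proj₂ (crossing-right k s))
      (Unique.++⁺ (squaresOf-Unique S (All.map proj₂ dominoes) matching) (proj₂ (crossing-left (suc k) t))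
        (Disjoint-⊆ id (map-proj₁⊆squaresOf D) (squaresOf-Disjoint S D apartSD)))
      (Disjoint-++ʳ (Disjoint-⊆ (map-proj₂⊆squaresOf C) id (squaresOf-Disjoint C S apartCS))
        (Disjoint-⊆ (map-proj₂⊆squaresOf C) (map-proj₁⊆squaresOf D) (squaresOf-Disjoint C D apartCD)))
    in-column : ∀ {x} → Cell (_≡ suc k) x → Cell (_∈ suc k ∷ []) x
    in-column {x} = Cell-map {_≡ suc k} {_∈ suc k ∷ []} x here
    cells : All (Cell (_∈ suc k ∷ [])) xs
    cells = All.++⁺ (All.map in-column (proj₁ (crossing-right k s)))
      (All.++⁺ (All.map in-column (squaresOf-All {Cell (_≡ suc k)} S (All.map proj₁ dominoes)))
               (All.map in-column (proj₁ (crossing-left (suc k) t))))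

-- Both bounds are needed because ∸ truncates.
uncovered-split : ∀ L N w x y z → x + (2 * y + z) ≤ L → 2 * w + x ≤ N →
  L + N ∸ z ∸ 2 * (w + (x + y)) ≡ (L ∸ z ∸ x ∸ 2 * y) + (N ∸ x ∸ 2 * w)
uncovered-split _ _ w x y z column prefix
  with r , refl ← m≤n⇒∃[o]m+o≡n column | s , refl ← m≤n⇒∃[o]m+o≡n prefix = begin
  Lᶜ + Nᵖ ∸ z ∸ 2 * (w + (x + y))
    ≡⟨ ∸-+-assoc (Lᶜ + Nᵖ) z _ ⟩
  Lᶜ + Nᵖ ∸ (z + 2 * (w + (x + y)))
    ≡⟨ cancel (z + 2 * (w + (x + y))) (total-rearrange x y z w r s) ⟩
  r + s
    ≡⟨ cong₂ _+_ column-rest prefix-rest ⟨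
  (Lᶜ ∸ z ∸ x ∸ 2 * y) + (Nᵖ ∸ x ∸ 2 * w) ∎
  where
  open ≡-Reasoning
  Lᶜ = x + (2 * y + z) + r
  Nᵖ = 2 * w + x + s
  cancel : ∀ {n} m {r} → n ≡ m + r → n ∸ m ≡ r
  cancel m {r} refl = m+n∸m≡n m r
  total-rearrange : ∀ x y z w r s → x + (2 * y + z) + r + (2 * w + x + s) ≡ z + 2 * (w + (x + y)) + (r + s)
  total-rearrange = solve-∀
  column-rearrange : ∀ x y z r → x + (2 * y + z) + r ≡ z + (x + 2 * y) + r
  column-rearrange = solve-∀
  prefix-rearrange : ∀ w x s → 2 * w + x + s ≡ x + 2 * w + s
  prefix-rearrange = solve-∀
  column-rest : Lᶜ ∸ z ∸ x ∸ 2 * y ≡ r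
  column-rest = trans (∸-+-assoc (Lᶜ ∸ z) x (2 * y))
    (trans (∸-+-assoc Lᶜ z (x + 2 * y)) (cancel (z + (x + 2 * y)) (column-rearrange x y z r)))
  prefix-rest : Nᵖ ∸ x ∸ 2 * w ≡ s
  prefix-rest = trans (∸-+-assoc Nᵖ x (2 * w)) (cancel (x + 2 * w) (prefix-rearrange w x s))

powers-split : ∀ a b L N w x y z → x + (2 * y + z) ≤ L → 2 * w + x ≤ N →
  a ^ (L + N ∸ z ∸ 2 * (w + (x + y))) * b ^ (w + (x + y))
    ≡ b ^ (x + y) * a ^ (L ∸ z ∸ x ∸ 2 * y) * (a ^ (N ∸ x ∸ 2 * w) * b ^ w)
powers-split a b L N w x y z column prefix = begin
  a ^ (L + N ∸ z ∸ 2 * (w + (x + y))) * b ^ (w + (x + y))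
    ≡⟨ cong₂ _*_ (trans (cong (a ^_) (uncovered-split L N w x y z column prefix))
                        (^-distribˡ-+-* a (L ∸ z ∸ x ∸ 2 * y) (N ∸ x ∸ 2 * w)))
                 (^-distribˡ-+-* b w (x + y)) ⟩
  a ^ (L ∸ z ∸ x ∸ 2 * y) * a ^ (N ∸ x ∸ 2 * w) * (b ^ w * b ^ (x + y))
    ≡⟨ reorder (a ^ (L ∸ z ∸ x ∸ 2 * y)) (a ^ (N ∸ x ∸ 2 * w)) (b ^ w) (b ^ (x + y)) ⟩
  b ^ (x + y) * a ^ (L ∸ z ∸ x ∸ 2 * y) * (a ^ (N ∸ x ∸ 2 * w) * b ^ w) ∎
  where
  open ≡-Reasoning
  reorder : ∀ c n w xy → c * n * (w * xy) ≡ xy * c * (n * w)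
  reorder = solve-∀

module Tilings (p a b : ℕ) where
  open Board p

  weight : ℕ → List Edge → ℕ
  weight e S = a ^ (e ∸ 2 * length S) * b ^ length S

  -- The exponent of a counts the squares covered neither by S nor by the outgoing dominoes D.
  boardTerm : Bool → ℕ → List Edge → List Edge → ℕ
  boardTerm u k D S = ⟦ avoiding S D ⟧ * ⟦ not u ∨ unbreakable (suc k) S ⟧ * weight (suc k * L ∸ length D) S

  boardSum : Bool → ℕ → Crossing → ℕ
  boardSum u k t = Σ⊆ (boardEdges q (suc k)) (boardTerm u k (crossing k t))

  columnTerm : ℕ → Crossing → Crossing → List Edge → ℕ
  columnTerm k s t S =
    ⟦ avoiding (C ++ S) D ⟧ * (b ^ (length C + length S) * a ^ (L ∸ length D ∸ length C ∸ 2 * length S))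
    where
    C = crossing k s
    D = crossing (suc k) t

  transferAt : ℕ → Crossing → Crossing → ℕ
  transferAt k s t = Σ⊆ (columnEdges q (suc k)) (columnTerm k s t)

  transfer : Crossing → Crossing → ℕ
  transfer = transferAt 0

  columnTerm-shift : ∀ k s t S → columnTerm k s t (map (shift k) S) ≡ columnTerm 0 s t S
  columnTerm-shift k s t S
    rewrite crossing-shift 0 k s | crossing-shift 1 k t
          | sym (map-++ (shift k) (crossing 0 s) S) | avoiding-shift k (crossing 0 s ++ S) (crossing 1 t)
          | length-map (shift k) (crossing 0 s) | length-map (shift k) S | length-map (shift k) (crossing 1 t)
    = refl

  transferAt-shift : ∀ k s t → transferAt k s t ≡ transfer s t
  transferAt-shift k s t = begin
    Σ⊆ (columnEdges q (1 + k)) (columnTerm k s t)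
      ≡⟨ cong (λ E → Σ⊆ E (columnTerm k s t)) (columnEdges-shift 1 k) ⟩
    Σ⊆ (map (shift k) (columnEdges q 1)) (columnTerm k s t)
      ≡⟨ Σ⊆-map (shift k) (columnEdges q 1) (columnTerm k s t) ⟩
    Σ⊆ (columnEdges q 1) (columnTerm k s t ∘ map (shift k))
      ≡⟨ Σ⊆-cong (columnEdges q 1) (columnTerm-shift k s t) ⟩
    transfer s t ∎
    where open ≡-Reasoning

  boardSum-zero : ∀ u t → boardSum u 0 t ≡ transfer none t
  boardSum-zero u t = begin
    Σ⊆ (boardEdges q 1) (boardTerm u 0 (crossing 0 t))
      ≡⟨ cong (λ E → Σ⊆ E (boardTerm u 0 (crossing 0 t))) boardEdges-one ⟩
    Σ⊆ (columnEdges q 0) (boardTerm u 0 (crossing 0 t))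
      ≡⟨ Σ⊆-cong (columnEdges q 0) first-column ⟩
    Σ⊆ (columnEdges q 0) (columnTerm 0 none t ∘ map (shift 1))
      ≡⟨ Σ⊆-map (shift 1) (columnEdges q 0) (columnTerm 0 none t) ⟨
    Σ⊆ (map (shift 1) (columnEdges q 0)) (columnTerm 0 none t)
      ≡⟨ cong (λ E → Σ⊆ E (columnTerm 0 none t)) (columnEdges-shift 0 1) ⟨
    transfer none t ∎
    where
    open ≡-Reasoning
    reorder : ∀ c x y → c * 1 * (x * y) ≡ c * (y * x)
    reorder = solve-∀
    first-column : ∀ S → boardTerm u 0 (crossing 0 t) S ≡ columnTerm 0 none t (map (shift 1) S)
    first-column S
      rewrite crossing-shift 0 1 t | avoiding-shift 1 S (crossing 0 t)
            | length-map (shift 1) S | length-map (shift 1) (crossing 0 t)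
            | ∨-zeroʳ (not u) | +-identityʳ L
      = reorder ⟦ avoiding S (crossing 0 t) ⟧ (a ^ (L ∸ length (crossing 0 t) ∸ 2 * length S)) (b ^ length S)

  weight-split : ∀ k s t S₁ S₃ → All (Domino (_≤ k)) S₁ → All (Domino (_≡ suc k)) S₃ →
    avoiding S₁ (crossing k s) ≡ true → avoiding (crossing k s ++ S₃) (crossing (suc k) t) ≡ true →
    weight ((2 + k) * L ∸ length (crossing (suc k) t)) (S₁ ++ (crossing k s ++ S₃))
      ≡ b ^ (length (crossing k s) + length S₃)
          * a ^ (L ∸ length (crossing (suc k) t) ∸ length (crossing k s) ∸ 2 * length S₃)
        * weight (suc k * L ∸ length (crossing k s)) S₁
  weight-split k s t S₁ S₃ dominoes₁ dominoes₃ avoid₁ avoid₃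
    rewrite length-++ S₁ {crossing k s ++ S₃} | length-++ (crossing k s) {S₃}
    = powers-split a b L (suc k * L) (length S₁) (length (crossing k s)) (length S₃) (length (crossing (suc k) t))
        (column-bound k s t S₃ dominoes₃ avoid₃) (prefix-bound k s S₁ dominoes₁ avoid₁)

  boardTerm-split : ∀ u k s t S₁ S₃ → All (Domino (_≤ k)) S₁ → All (Domino (_≡ suc k)) S₃ →
    boardTerm u (suc k) (crossing (suc k) t) (S₁ ++ (crossing k s ++ S₃))
      ≡ ⟦ not u ∨ crossed s ⟧ * columnTerm k s t S₃ * boardTerm u k (crossing k s) S₁
  boardTerm-split u k s t S₁ S₃ dominoes₁ dominoes₃ = begin
    ⟦ avoiding S D ⟧ * ⟦ not u ∨ unbreakable (2 + k) S ⟧ * W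
      ≡⟨ cong₂ (λ x y → ⟦ x ⟧ * ⟦ not u ∨ y ⟧ * W) avoiding-S unbreakable-S ⟩
    ⟦ A₁ ∧ A₃ ⟧ * ⟦ not u ∨ (U₁ ∧ crossed s) ⟧ * W
      ≡⟨ cong₂ (λ x y → x * y * W) (⟦∧⟧ A₁ A₃)
               (trans (cong ⟦_⟧ (∨-distribˡ-∧ (not u) U₁ (crossed s)))
                      (⟦∧⟧ (not u ∨ U₁) (not u ∨ crossed s))) ⟩
    ⟦ A₁ ⟧ * ⟦ A₃ ⟧ * (⟦ not u ∨ U₁ ⟧ * ⟦ not u ∨ crossed s ⟧) * W
      ≡⟨ reorder₁ ⟦ A₁ ⟧ ⟦ A₃ ⟧ ⟦ not u ∨ U₁ ⟧ ⟦ not u ∨ crossed s ⟧ W ⟩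
    ⟦ A₁ ⟧ * (⟦ A₃ ⟧ * W) * (⟦ not u ∨ U₁ ⟧ * ⟦ not u ∨ crossed s ⟧)
      ≡⟨ cong (_* (⟦ not u ∨ U₁ ⟧ * ⟦ not u ∨ crossed s ⟧))
              (⟦⟧-guard A₁ (λ avoid₁ → ⟦⟧-guard A₃ (λ avoid₃ →
                 weight-split k s t S₁ S₃ dominoes₁ dominoes₃ avoid₁ avoid₃))) ⟩
    ⟦ A₁ ⟧ * (⟦ A₃ ⟧ * (c * W₁)) * (⟦ not u ∨ U₁ ⟧ * ⟦ not u ∨ crossed s ⟧)
      ≡⟨ reorder₂ ⟦ A₁ ⟧ ⟦ A₃ ⟧ c W₁ ⟦ not u ∨ U₁ ⟧ ⟦ not u ∨ crossed s ⟧ ⟩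
    ⟦ not u ∨ crossed s ⟧ * (⟦ A₃ ⟧ * c) * (⟦ A₁ ⟧ * ⟦ not u ∨ U₁ ⟧ * W₁) ∎
    where
    open ≡-Reasoning
    C = crossing k s
    D = crossing (suc k) t
    S = S₁ ++ (C ++ S₃)
    W = weight ((2 + k) * L ∸ length D) S
    W₁ = weight (suc k * L ∸ length C) S₁
    c = b ^ (length C + length S₃) * a ^ (L ∸ length D ∸ length C ∸ 2 * length S₃)
    A₁ = avoiding S₁ C
    A₃ = avoiding (C ++ S₃) D
    U₁ = unbreakable (suc k) S₁
    columns₁ : All (Columns≤ k) S₁
    columns₁ = All.map (λ {e} → Domino⇒Columns≤ e) dominoes₁
    columns₃ : All (Columns≥ (suc k)) S₃
    columns₃ = All.map (λ {e} → Domino⇒Columns≥ e) dominoes₃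
    avoiding-S : avoiding S D ≡ A₁ ∧ A₃
    avoiding-S = avoiding-split S₁ C S₃ D (allDisjoint-separated S₁ S₃ columns₁ columns₃)
      (allDisjoint-separated S₁ D columns₁ (crossing-Columns≥ (suc k) t))
    unbreakable-S : unbreakable (2 + k) S ≡ U₁ ∧ crossed s
    unbreakable-S = trans (unbreakable-split k S₁ C S₃ columns₁ (crossing-Columns≥ k s) columns₃)
      (cong (U₁ ∧_) (crossing-crosses k s))
    reorder₁ : ∀ a₁ a₃ u x w → a₁ * a₃ * (u * x) * w ≡ a₁ * (a₃ * w) * (u * x)
    reorder₁ = solve-∀
    reorder₂ : ∀ a₁ a₃ c w₁ u x → a₁ * (a₃ * (c * w₁)) * (u * x) ≡ x * (a₃ * c) * (a₁ * u * w₁)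
    reorder₂ = solve-∀

  boardSum-suc : ∀ u k t →
    boardSum u (suc k) t ≡ Σᶜ (λ s → ⟦ not u ∨ crossed s ⟧ * (transfer s t * boardSum u k s))
  boardSum-suc u k t = begin
    Σ⊆ (boardEdges q (2 + k)) F
      ≡⟨ cong (λ E → Σ⊆ E F) (boardEdges-suc k) ⟩
    Σ⊆ (B ++ (crossEdges q k ++ column)) F
      ≡⟨ Σ⊆-++ B (crossEdges q k ++ column) F ⟩
    Σ⊆ B (λ S₁ → Σ⊆ (crossEdges q k ++ column) (λ T → F (S₁ ++ T)))
      ≡⟨ Σ⊆-cong B (λ S₁ → trans (Σ⊆-++ (crossEdges q k) column (λ T → F (S₁ ++ T)))
                                   (Σ⊆-crossEdges k (λ C → Σ⊆ column (λ S₃ → F (S₁ ++ (C ++ S₃)))))) ⟩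
    Σ⊆ B (λ S₁ → Σᶜ (λ s → Σ⊆ column (λ S₃ → F (S₁ ++ (crossing k s ++ S₃)))))
      ≡⟨ Σ⊆-congᴬ B (boardEdges-Domino k) (λ S₁ dominoes₁ → Σᶜ-cong (λ s →
           Σ⊆-congᴬ column (columnEdges-Domino (suc k)) (λ S₃ dominoes₃ →
             boardTerm-split u k s t S₁ S₃ dominoes₁ dominoes₃))) ⟩
    Σ⊆ B (λ S₁ → Σᶜ (λ s → Σ⊆ column (λ S₃ → K s S₃ * G s S₁)))
      ≡⟨ Σ⊆-cong B (λ S₁ → Σᶜ-cong (λ s → Σ⊆-*ʳ column (G s S₁) (K s))) ⟩
    Σ⊆ B (λ S₁ → Σᶜ (λ s → Σ⊆ column (K s) * G s S₁))
      ≡⟨ Σ⊆-Σᶜ B (λ s S₁ → Σ⊆ column (K s) * G s S₁) ⟩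
    Σᶜ (λ s → Σ⊆ B (λ S₁ → Σ⊆ column (K s) * G s S₁))
      ≡⟨ Σᶜ-cong (λ s → Σ⊆-*ˡ B (Σ⊆ column (K s)) (G s)) ⟩
    Σᶜ (λ s → Σ⊆ column (K s) * boardSum u k s)
      ≡⟨ Σᶜ-cong (λ s → trans (cong (_* boardSum u k s) (column-sum s))
                               (*-assoc ⟦ not u ∨ crossed s ⟧ (transfer s t) (boardSum u k s))) ⟩
    Σᶜ (λ s → ⟦ not u ∨ crossed s ⟧ * (transfer s t * boardSum u k s)) ∎
    where
    open ≡-Reasoning
    B = boardEdges q (suc k)
    column = columnEdges q (suc k)
    F = boardTerm u (suc k) (crossing (suc k) t)
    K : Crossing → List Edge → ℕ
    K s S₃ = ⟦ not u ∨ crossed s ⟧ * columnTerm k s t S₃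
    G : Crossing → List Edge → ℕ
    G s = boardTerm u k (crossing k s)
    column-sum : ∀ s → Σ⊆ column (K s) ≡ ⟦ not u ∨ crossed s ⟧ * transfer s t
    column-sum s = trans (Σ⊆-*ˡ column ⟦ not u ∨ crossed s ⟧ (columnTerm k s t))
                         (cong (⟦ not u ∨ crossed s ⟧ *_) (transferAt-shift k s t))

  open TransferMatrix transfer

  boardSum-Z : ∀ k t → boardSum false k t ≡ Z (suc k) t
  boardSum-Z zero t = trans (boardSum-zero false t) (sym (Z-one t))
  boardSum-Z (suc k) t = trans (boardSum-suc false k t)
    (Σᶜ-cong (λ s → trans (*-identityˡ (transfer s t * boardSum false k s))
                          (cong (transfer s t *_) (boardSum-Z k s))))

  boardSum-Zᵘ : ∀ k t → boardSum true k t ≡ Zᵘ (suc k) t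
  boardSum-Zᵘ zero t = boardSum-zero true t
  boardSum-Zᵘ (suc k) t = trans (boardSum-suc true k t)
    (Σᶜ-cong (λ s → cong (λ x → ⟦ crossed s ⟧ * (transfer s t * x)) (boardSum-Zᵘ k s)))

  avoiding-[] : ∀ S → avoiding S [] ≡ isMatching S
  avoiding-[] S = trans (cong (isMatching S ∧_) (allDisjoint-[] S)) (∧-identityʳ _)

  R-Z : ∀ n → R q a b n ≡ Z n none
  R-Z zero = refl
  R-Z (suc k) = begin
    sum (map (colorings q a b (suc k)) (filterᵇ isMatching (subsets B)))
      ≡⟨ sum-map-filterᵇ isMatching _ (subsets B) ⟩
    sum (map (λ S → ⟦ isMatching S ⟧ * colorings q a b (suc k) S) (subsets B))
      ≡⟨ sum-map-subsets B _ ⟩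
    Σ⊆ B (λ S → ⟦ isMatching S ⟧ * colorings q a b (suc k) S)
      ≡⟨ Σ⊆-cong B (λ S → cong (_* colorings q a b (suc k) S)
                              (sym (trans (*-identityʳ _) (cong ⟦_⟧ (avoiding-[] S))))) ⟩
    boardSum false k none
      ≡⟨ boardSum-Z k none ⟩
    Z (suc k) none ∎
    where
    open ≡-Reasoning
    B = boardEdges q (suc k)

  Rt-Zᵘ : ∀ k → Rt q a b (suc k) ≡ Zᵘ (suc k) none
  Rt-Zᵘ k = begin
    sum (map (colorings q a b (suc k)) (filterᵇ (unbreakable (suc k)) (filterᵇ isMatching (subsets B))))
      ≡⟨ sum-map-filterᵇ (unbreakable (suc k)) _ (filterᵇ isMatching (subsets B)) ⟩
    sum (map (λ S → ⟦ unbreakable (suc k) S ⟧ * colorings q a b (suc k) S) (filterᵇ isMatching (subsets B)))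
      ≡⟨ sum-map-filterᵇ isMatching _ (subsets B) ⟩
    sum (map (λ S → ⟦ isMatching S ⟧ * (⟦ unbreakable (suc k) S ⟧ * colorings q a b (suc k) S)) (subsets B))
      ≡⟨ sum-map-subsets B _ ⟩
    Σ⊆ B (λ S → ⟦ isMatching S ⟧ * (⟦ unbreakable (suc k) S ⟧ * colorings q a b (suc k) S))
      ≡⟨ Σ⊆-cong B (λ S → trans (sym (*-assoc ⟦ isMatching S ⟧ ⟦ unbreakable (suc k) S ⟧ _))
           (cong (λ x → ⟦ x ⟧ * ⟦ unbreakable (suc k) S ⟧ * colorings q a b (suc k) S) (sym (avoiding-[] S)))) ⟩
    boardSum true k none
      ≡⟨ boardSum-Zᵘ k none ⟩
    Zᵘ (suc k) none ∎
    where
    open ≡-Reasoning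
    B = boardEdges q (suc k)

  R-renewal : ∀ n → 1 ≤ n → R q a b n ≡ Σ1 n (λ k → R q a b (n ∸ k) * Rt q a b k)
  R-renewal n 1≤n = begin
    R q a b n
      ≡⟨ R-Z n ⟩
    Z n none
      ≡⟨ Z-renewal n 1≤n ⟩
    Σ1 n (λ k → Z (n ∸ k) none * Zᵘ k none)
      ≡⟨ Σ1-cong n (λ { (suc k) _ _ → cong₂ _*_ (sym (R-Z (n ∸ suc k))) (sym (Rt-Zᵘ k)) }) ⟩
    Σ1 n (λ k → R q a b (n ∸ k) * Rt q a b k) ∎
    where open ≡-Reasoning

mainTheorem7 : (q : ℕ) → 4 ≤ q → (a b : ℕ) → 1 ≤ a → 1 ≤ b → (m n : ℕ) → 1 ≤ m → 1 ≤ n →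
    R q a b (n + m) ≡ R q a b n * R q a b m
      + Σ1 n (λ i → Σ1 m (λ j → R q a b (n ∸ i) * R q a b (m ∸ j) * Rt q a b (i + j)))
mainTheorem7 (suc (suc (suc (suc p)))) (s≤s (s≤s (s≤s (s≤s z≤n)))) a b _ _ m n _ _ =
  Renewal.renewal-split (R (4 + p) a b) (Rt (4 + p) a b) refl (Tilings.R-renewal p a b) m n
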